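{- Let $M$ be a matroid on ground set $E$ with a circuit-hyperplane $X$. If $A$ is a non-trivial parallel class of $M$ (a parallel class with at least two elements), then either $A\subseteq E-X$, or $A=X$ and $|A|=2$. -}

module Defs where

open import Data.Nat using (ℕ; suc; _≤_; _<_)
open import Data.Fin using (Fin)
open import Data.Fin.Subset
  using (Subset; _∈_; _∉_; _⊆_; _⊂_; _∪_; ⁅_⁆; ∣_∣; ⊤)
  renaming (⊥ to ∅)
open import Data.Product using (Σ; ∃; _×_)
open import Relation.Nullary using (¬_)
open import Relation.Binary.PropositionalEquality using (_≡_; _≢_)

record Matroid (n : ℕ) : Set₁ where
  field
    Indep       : Subset n → Set
    indep-∅     : Indep ∅
    indep-↓     : ∀ {I J} → J ⊆ I → Indep I → Indep J
    indep-aug   : ∀ {I J} → Indep I → Indep J → ∣ I ∣ < ∣ J ∣ →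
                  ∃ λ e → e ∈ J × e ∉ I × Indep (I ∪ ⁅ e ⁆)

module _ {n : ℕ} (M : Matroid n) where
  open Matroid M

  Dependent : Subset n → Set
  Dependent X = ¬ Indep X

  Circuit : Subset n → Set
  Circuit C = Dependent C × (∀ D → D ⊂ C → Indep D)

  HasRank : Subset n → ℕ → Set
  HasRank X k = (∃ λ I → I ⊆ X × Indep I × ∣ I ∣ ≡ k)
              × (∀ I → I ⊆ X → Indep I → ∣ I ∣ ≤ k)

  Flat : Subset n → Set
  Flat X = ∀ e → e ∉ X → ∀ k → HasRank X k → ¬ HasRank (X ∪ ⁅ e ⁆) k

  Hyperplane : Subset n → Set
  Hyperplane X = Flat X × ∃ λ k → HasRank X k × HasRank ⊤ (suc k)

  CircuitHyperplane : Subset n → Set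
  CircuitHyperplane X = Circuit X × Hyperplane X

  Loop : Fin n → Set
  Loop e = Circuit ⁅ e ⁆

  -- e and f are parallel: {e, f} is a circuit (for e ≢ f).
  Parallel : Fin n → Fin n → Set
  Parallel e f = Circuit (⁅ e ⁆ ∪ ⁅ f ⁆)

  ParallelSet : Subset n → Set
  ParallelSet A = (∀ e → e ∈ A → ¬ Loop e)
                × (∀ e f → e ∈ A → f ∈ A → e ≢ f → Parallel e f)

  ParallelClass : Subset n → Set
  ParallelClass A = ParallelSet A × (∀ B → A ⊆ B → ParallelSet B → B ⊆ A)

-- If a parallel class A meets the circuit-hyperplane X in e, then every other
-- f ∈ A lies in the closure of {e} ⊆ X, and X is a flat, so A ⊆ X. Then the
-- circuit {e, f} sits inside the circuit X, so by minimality X = {e, f} ⊆ A.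
module Submission where

open import Defs
open import Data.Nat using (ℕ; _≤_; _<_; _+_; suc; s≤s; z≤n)
open import Data.Nat.Properties
open import Data.Fin using (Fin) renaming (_≟_ to _≟ᶠ_)
open import Data.Fin.Subset
  using (Subset; _⊆_; _⊂_; ∁; ∣_∣; _∈_; _∉_; _∪_; _∩_; ⁅_⁆; inside; outside)
open import Data.Fin.Subset.Properties
open import Data.Fin.Properties using (any?)
open import Data.Vec using ([]; _∷_)
open import Data.Product using (_×_; _,_; ∃; proj₁)
open import Data.Sum using (_⊎_; inj₁; inj₂; [_,_]′)
open import Data.Empty using (⊥-elim)
open import Relation.Nullary using (yes; no; ¬?; _×-dec_)
open import Relation.Binary.PropositionalEquality using (_≡_; _≢_; ≢-sym; refl; sym; subst)

∣p∪q∣≤∣p∣+∣q∣ : ∀ {n} (p q : Subset n) → ∣ p ∪ q ∣ ≤ ∣ p ∣ + ∣ q ∣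
∣p∪q∣≤∣p∣+∣q∣ [] [] = z≤n
∣p∪q∣≤∣p∣+∣q∣ (outside ∷ p) (outside ∷ q) = ∣p∪q∣≤∣p∣+∣q∣ p q
∣p∪q∣≤∣p∣+∣q∣ (outside ∷ p) (inside ∷ q) =
  ≤-trans (s≤s (∣p∪q∣≤∣p∣+∣q∣ p q)) (≤-reflexive (sym (+-suc ∣ p ∣ ∣ q ∣)))
∣p∪q∣≤∣p∣+∣q∣ (inside ∷ p) (outside ∷ q) = s≤s (∣p∪q∣≤∣p∣+∣q∣ p q)
∣p∪q∣≤∣p∣+∣q∣ (inside ∷ p) (inside ∷ q) =
  s≤s (≤-trans (m≤n⇒m≤1+n (∣p∪q∣≤∣p∣+∣q∣ p q)) (≤-reflexive (sym (+-suc ∣ p ∣ ∣ q ∣))))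

module _ {n : ℕ} where

  ∣⁅x⁆∪⁅y⁆∣≤2 : ∀ (x y : Fin n) → ∣ ⁅ x ⁆ ∪ ⁅ y ⁆ ∣ ≤ 2
  ∣⁅x⁆∪⁅y⁆∣≤2 x y with ∣p∪q∣≤∣p∣+∣q∣ ⁅ x ⁆ ⁅ y ⁆
  ... | bound rewrite ∣⁅x⁆∣≡1 x | ∣⁅x⁆∣≡1 y = bound

  x∈p⇒⁅x⁆⊆p : ∀ {x} {p : Subset n} → x ∈ p → ⁅ x ⁆ ⊆ p
  x∈p⇒⁅x⁆⊆p {x} {p} x∈p y∈⁅x⁆ = subst (_∈ p) (sym (x∈⁅y⁆⇒x≡y x y∈⁅x⁆)) x∈p

  ∪-lub : ∀ {p q r : Subset n} → p ⊆ r → q ⊆ r → p ∪ q ⊆ r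
  ∪-lub {p} {q} p⊆r q⊆r x∈p∪q = [ p⊆r , q⊆r ]′ (x∈p∪q⁻ p q x∈p∪q)

  ⁅x⁆⊂⁅x⁆∪⁅y⁆ : ∀ {x y : Fin n} → x ≢ y → ⁅ x ⁆ ⊂ ⁅ x ⁆ ∪ ⁅ y ⁆
  ⁅x⁆⊂⁅x⁆∪⁅y⁆ {x} {y} x≢y =
    p⊆p∪q ⁅ y ⁆ , y , q⊆p∪q ⁅ x ⁆ ⁅ y ⁆ (x∈⁅x⁆ y) , x≢y⇒x∉⁅y⁆ (≢-sym x≢y)

  p⊂p∪⁅x⁆ : ∀ (p : Subset n) {x} → x ∉ p → p ⊂ p ∪ ⁅ x ⁆
  p⊂p∪⁅x⁆ p {x} x∉p = p⊆p∪q ⁅ x ⁆ , x , q⊆p∪q p ⁅ x ⁆ (x∈⁅x⁆ x) , x∉p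

  2≤∣p∣⇒∃x∈p×x≢y : ∀ {p : Subset n} → 2 ≤ ∣ p ∣ → ∀ y → ∃ λ x → x ∈ p × x ≢ y
  2≤∣p∣⇒∃x∈p×x≢y {p} 2≤∣p∣ y with any? (λ x → (x ∈? p) ×-dec ¬? (x ≟ᶠ y))
  ... | yes found = found
  ... | no none = ⊥-elim (<⇒≱ 2≤∣p∣ (≤-trans (p⊆q⇒∣p∣≤∣q∣ p⊆⁅y⁆) (≤-reflexive (∣⁅x⁆∣≡1 y))))
    where
    p⊆⁅y⁆ : p ⊆ ⁅ y ⁆
    p⊆⁅y⁆ {x} x∈p with x ≟ᶠ y
    ... | yes refl = x∈⁅x⁆ y
    ... | no x≢y = ⊥-elim (none (x , x∈p , x≢y))

module _ {n : ℕ} (M : Matroid n) where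
  open Matroid M

  circuit-⊆-dependent⇒⊇ : ∀ {C D} → Circuit M C → D ⊆ C → Dependent M D → C ⊆ D
  circuit-⊆-dependent⇒⊇ {C} {D} (_ , minimal) D⊆C dependent {x} x∈C with x ∈? D
  ... | yes x∈D = x∈D
  ... | no x∉D = ⊥-elim (dependent (minimal D (D⊆C , x , x∈C , x∉D)))

  parallel⇒indep-⁅x⁆ : ∀ {x y} → x ≢ y → Parallel M x y → Indep ⁅ x ⁆
  parallel⇒indep-⁅x⁆ {x} x≢y (_ , minimal) = minimal ⁅ x ⁆ (⁅x⁆⊂⁅x⁆∪⁅y⁆ x≢y)

  indep-extend-to-rank : ∀ {X D k} → HasRank M X k → Indep D → D ⊆ X →
                         ∃ λ K → D ⊆ K × K ⊆ X × Indep K × k ≤ ∣ K ∣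
  indep-extend-to-rank {X} {D} {k} ((I , I⊆X , indep-I , ∣I∣≡k) , _) indep-D D⊆X =
    grow k D (m≤n+m k ∣ D ∣) ⊆-refl D⊆X indep-D
    where
    grow : ∀ fuel K → k ≤ ∣ K ∣ + fuel → D ⊆ K → K ⊆ X → Indep K →
           ∃ λ K' → D ⊆ K' × K' ⊆ X × Indep K' × k ≤ ∣ K' ∣
    grow fuel K k≤ D⊆K K⊆X indep-K with k ≤? ∣ K ∣
    ... | yes k≤∣K∣ = K , D⊆K , K⊆X , indep-K , k≤∣K∣
    grow 0 K k≤ D⊆K K⊆X indep-K | no k≰∣K∣ =
      ⊥-elim (k≰∣K∣ (≤-trans k≤ (≤-reflexive (+-identityʳ ∣ K ∣))))
    grow (suc fuel) K k≤ D⊆K K⊆X indep-K | no k≰∣K∣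
      with indep-aug indep-K indep-I (subst (∣ K ∣ <_) (sym ∣I∣≡k) (≰⇒> k≰∣K∣))
    ... | g , g∈I , g∉K , indep-K∪g =
      grow fuel (K ∪ ⁅ g ⁆)
        (≤-trans k≤ (≤-trans (≤-reflexive (+-suc ∣ K ∣ fuel)) (+-monoˡ-≤ fuel (p⊂q⇒∣p∣<∣q∣ (p⊂p∪⁅x⁆ K g∉K)))))
        (⊆-trans D⊆K (p⊆p∪q ⁅ g ⁆)) (∪-lub K⊆X (x∈p⇒⁅x⁆⊆p (I⊆X g∈I))) indep-K∪g

  -- An independent J ⊆ X ∪ {f} with |J| > k would augment a rank-k extension K
  -- of D inside X, either beyond rank k within X, or by f, which makes D ∪ {f} ⊆ K ∪ {f}.
  hasRank-∪-dependent : ∀ {X D k f} → HasRank M X k → Indep D → D ⊆ X →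
                        Dependent M (D ∪ ⁅ f ⁆) → HasRank M (X ∪ ⁅ f ⁆) k
  hasRank-∪-dependent {X} {D} {k} {f} rank@((I , I⊆X , indep-I , ∣I∣≡k) , bound) indep-D D⊆X dependent =
    (I , ⊆-trans I⊆X (p⊆p∪q ⁅ f ⁆) , indep-I , ∣I∣≡k) , bound′
    where
    bound′ : ∀ J → J ⊆ X ∪ ⁅ f ⁆ → Indep J → ∣ J ∣ ≤ k
    bound′ J J⊆ indep-J with ∣ J ∣ ≤? k
    ... | yes ∣J∣≤k = ∣J∣≤k
    ... | no ∣J∣≰k with indep-extend-to-rank rank indep-D D⊆X
    ... | K , D⊆K , K⊆X , indep-K , k≤∣K∣
      with indep-aug indep-K indep-J (≤-<-trans (bound K K⊆X indep-K) (≰⇒> ∣J∣≰k))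
    ... | g , g∈J , g∉K , indep-K∪g with x∈p∪q⁻ X ⁅ f ⁆ (J⊆ g∈J)
    ... | inj₁ g∈X =
      ⊥-elim (<⇒≱ (≤-<-trans k≤∣K∣ (p⊂q⇒∣p∣<∣q∣ (p⊂p∪⁅x⁆ K g∉K)))
                  (bound (K ∪ ⁅ g ⁆) (∪-lub K⊆X (x∈p⇒⁅x⁆⊆p g∈X)) indep-K∪g))
    ... | inj₂ g∈⁅f⁆ rewrite x∈⁅y⁆⇒x≡y f g∈⁅f⁆ =
      ⊥-elim (dependent (indep-↓ (∪-lub (⊆-trans D⊆K (p⊆p∪q ⁅ f ⁆)) (q⊆p∪q K ⁅ f ⁆)) indep-K∪g))

  flat-closed : ∀ {X D k f} → Flat M X → HasRank M X k → Indep D → D ⊆ X →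
                Dependent M (D ∪ ⁅ f ⁆) → f ∈ X
  flat-closed {X} {f = f} flat rank indep-D D⊆X dependent with f ∈? X
  ... | yes f∈X = f∈X
  ... | no f∉X = ⊥-elim (flat f f∉X _ rank (hasRank-∪-dependent rank indep-D D⊆X dependent))

lemma2p10 : ∀ {n : ℕ} (M : Matroid n) (X A : Subset n) →
    CircuitHyperplane M X → ParallelClass M A → 2 ≤ ∣ A ∣ →
    A ⊆ ∁ X ⊎ (A ≡ X × ∣ A ∣ ≡ 2)
lemma2p10 M X A (circuit-X , flat , _ , rank , _) ((_ , parallel) , _) 2≤∣A∣
  with nonempty? (A ∩ X)
... | no A∩X-empty = inj₁ λ {x} x∈A → x∉p⇒x∈∁p λ x∈X → A∩X-empty (x , x∈p∩q⁺ (x∈A , x∈X))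
... | yes (e , e∈A∩X) with x∈p∩q⁻ A X e∈A∩X | 2≤∣p∣⇒∃x∈p×x≢y 2≤∣A∣ e
... | e∈A , e∈X | f , f∈A , f≢e =
  inj₂ (⊆-antisym A⊆X (⊆-trans X⊆P P⊆A) , ≤-antisym ∣A∣≤2 2≤∣A∣)
  where
  P : Subset _
  P = ⁅ e ⁆ ∪ ⁅ f ⁆

  A⊆X : A ⊆ X
  A⊆X {x} x∈A with x ≟ᶠ e
  ... | yes refl = e∈X
  ... | no x≢e = flat-closed M flat rank (parallel⇒indep-⁅x⁆ M (≢-sym x≢e) e∥x) (x∈p⇒⁅x⁆⊆p e∈X) (proj₁ e∥x)
    where
    e∥x : Parallel M e x
    e∥x = parallel e x e∈A x∈A (≢-sym x≢e)

  P⊆A : P ⊆ A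
  P⊆A = ∪-lub (x∈p⇒⁅x⁆⊆p e∈A) (x∈p⇒⁅x⁆⊆p f∈A)

  X⊆P : X ⊆ P
  X⊆P = circuit-⊆-dependent⇒⊇ M circuit-X (⊆-trans P⊆A A⊆X)
          (proj₁ (parallel e f e∈A f∈A (≢-sym f≢e)))

  ∣A∣≤2 : ∣ A ∣ ≤ 2
  ∣A∣≤2 = ≤-trans (p⊆q⇒∣p∣≤∣q∣ (⊆-trans A⊆X X⊆P)) (∣⁅x⁆∪⁅y⁆∣≤2 e f)
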